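{- There exist an algorithm for the unweighted fractional batched set cover problem and an absolute constant $C>0$ such that for every $m\geq 1$, every collection $\mathcal{S}$ of $m$ subsets of a finite ground set $X$, and every sequence of batches revealed by an oblivious adversary, the (expected) total cost of the algorithm is at most $C\cdot H_m\cdot\mathrm{OPT}$, where $\mathrm{OPT}$ is the optimal offline fractional cost.
   Context: Unweighted fractional batched set cover: a ground set $X$ and a collection $\mathcal{S}=\{S_1,\dots,S_m\}$ of subsets of $X$ are known in advance. The algorithm maintains variables $x_1,\dots,x_m\geq 0$ which may only be increased. An adversary reveals a sequence of batches $\beta_1,\beta_2,\dots$, each a finite subset of $X$ whose elements lie in at least one member of $\mathcal{S}$, one batch at a time; all elements of a batch and their set memberships are revealed simultaneously, and after processing $\beta_k$ the algorithm must ensure $\sum_{j:\sigma\in S_j}x_j\geq 1$ for all $\sigma\in\beta_k$. Cost is $\sum_j x_j$; $\mathrm{OPT}$ is the minimum of $\sum_j x_j$ over $x\geq 0$ satisfying all revealed constraints. An oblivious adversary fixes the batch sequence in advance. $H_m=\sum_{i=1}^m 1/i$. -}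

module Defs where

open import Data.Nat using (ℕ; zero; suc)
open import Data.Integer using (+_)
open import Data.Fin using (Fin; zero; suc)
open import Data.Bool using (Bool; true; if_then_else_)
open import Relation.Binary.PropositionalEquality using (_≡_)
open import Data.List using (List; []; _∷_; _++_)
open import Data.List.Membership.Propositional using (_∈_)
open import Data.List.Relation.Unary.All using (All)
open import Data.Product using (Σ; ∃; _×_)
open import Data.Rational using (ℚ; 0ℚ; 1ℚ; _+_; _*_; _≤_; _<_; _/_)

sumFin : (m : ℕ) → (Fin m → ℚ) → ℚ
sumFin zero    f = 0ℚ
sumFin (suc m) f = f zero + sumFin m (λ i → f (suc i))

H : ℕ → ℚ
H zero    = 0ℚ
H (suc k) = H k + (+ 1 / suc k)

-- A set system: m sets over the ground set X = Fin n; S j σ = true iff σ ∈ S_j.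
SetSystem : ℕ → ℕ → Set
SetSystem n m = Fin m → Fin n → Bool

Batch : ℕ → Set
Batch n = List (Fin n)

Assign : ℕ → Set
Assign m = Fin m → ℚ

cost : {m : ℕ} → Assign m → ℚ
cost {m} x = sumFin m x

coverage : {n m : ℕ} → SetSystem n m → Assign m → Fin n → ℚ
coverage {n} {m} S x σ = sumFin m (λ j → if S j σ then x j else 0ℚ)

Nonneg : {m : ℕ} → Assign m → Set
Nonneg x = ∀ j → 0ℚ ≤ x j

_≤ᵥ_ : {m : ℕ} → Assign m → Assign m → Set
x ≤ᵥ y = ∀ j → x j ≤ y j

Coverable : {n m : ℕ} → SetSystem n m → Fin n → Set
Coverable {n} {m} S σ = ∃ λ (j : Fin m) → S j σ ≡ true

ValidBatch : {n m : ℕ} → SetSystem n m → Batch n → Set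
ValidBatch S b = All (Coverable S) b

ValidSeq : {n m : ℕ} → SetSystem n m → List (Batch n) → Set
ValidSeq S bs = All (ValidBatch S) bs

FeasibleFor : {n m : ℕ} → SetSystem n m → List (Batch n) → Assign m → Set
FeasibleFor S bs x = Nonneg x × All (λ b → All (λ σ → 1ℚ ≤ coverage S x σ) b) bs

-- An online (deterministic) algorithm: it knows n, m and S in advance, and after
-- the batches revealed so far (in order, oldest first) it outputs the current x.
-- Since the output only depends on the prefix revealed so far, it is online.
Algorithm : Set
Algorithm = (n m : ℕ) → SetSystem n m → List (Batch n) → Assign m

Correct : Algorithm → Set
Correct A = ∀ (n m : ℕ) (S : SetSystem n m) →
    Nonneg (A n m S [])
  × (∀ (hist : List (Batch n)) (b : Batch n) →
       ValidSeq S hist → ValidBatch S b →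
       (A n m S hist ≤ᵥ A n m S (hist ++ (b ∷ [])))
       × All (λ σ → 1ℚ ≤ coverage S (A n m S (hist ++ (b ∷ []))) σ) b)

module Submission where

-- Every set j carries a level ℓ_j ∈ ℕ of weight val ℓ_j, where
-- val 0 = 0 and val (l+1) = 2^l, and the algorithm outputs x_j = val ℓ_j / m.
-- The elements of a batch are handled one at a time: while an element σ has
-- weighted coverage below m (that is, fractional coverage below 1), every set
-- containing σ is raised one level.  Levels only grow, so x only increases, and
-- m + 1 raises always suffice because a level-(m+1) set alone has weight 2^m ≥ m.
--
-- Fix a feasible y and the potential Φ = Σ_j y_j · ℓ_j.  A raise for
-- σ increases Φ by the y-coverage of σ, which is ≥ 1, while the total weight
-- grows by at most (weighted coverage of σ) + m < 2m.  Hence the invariant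
-- Σ_j val ℓ_j ≤ 2m·Φ, and since raised sets had weight < m, also val ℓ_j < 2m.
-- The latter bounds every level by 2·H_m (harmonic numbers grow like log₂),
-- so Φ ≤ 2·H_m·cost y and cost x = (Σ_j val ℓ_j)/m ≤ 4·H_m·cost y.

open import Defs
open import Data.Nat as ℕ using (ℕ; zero; suc; z≤n; s≤s; _≤′_; ≤′-step; ≤′-refl; _≥_)
import Data.Nat.Properties as ℕₚ
open import Data.Integer using (+_)
import Data.Integer.Solver as ℤ-Solver
open import Data.Fin using (Fin; zero; suc)
open import Data.Bool using (true; false; if_then_else_)
open import Data.List using (List; []; _∷_; _++_; foldl)
open import Data.List.Properties using (foldl-++)
open import Data.List.Relation.Unary.All as All using (All; []; _∷_)
open import Data.Product using (Σ; _,_; proj₁; proj₂; _×_)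
open import Data.Unit using (tt)
open import Relation.Nullary using (yes; no)
open import Relation.Binary.PropositionalEquality
open import Data.Rational using (ℚ; 0ℚ; 1ℚ; _+_; _*_; _≤_; _<_; _/_; _≤?_; toℚᵘ; positive; nonNegative)
open import Data.Rational.Properties
import Data.Rational.Unnormalised as ℚᵘ
import Data.Rational.Unnormalised.Properties as ℚᵘ
open import Data.Rational.Solver using (module +-*-Solver)

*-monoˡ-≤-≥0 : ∀ {r p q} → 0ℚ ≤ r → p ≤ q → r * p ≤ r * q
*-monoˡ-≤-≥0 {r} 0≤r = *-monoˡ-≤-nonNeg r {{nonNegative 0≤r}}

*-monoʳ-≤-≥0 : ∀ {r p q} → 0ℚ ≤ r → p ≤ q → p * r ≤ q * r
*-monoʳ-≤-≥0 {r} 0≤r = *-monoʳ-≤-nonNeg r {{nonNegative 0≤r}}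

*-≥0 : ∀ {p q} → 0ℚ ≤ p → 0ℚ ≤ q → 0ℚ ≤ p * q
*-≥0 {p} {q} 0≤p 0≤q = nonNegative⁻¹ _ {{nonNeg*nonNeg⇒nonNeg p {{nonNegative 0≤p}} q {{nonNegative 0≤q}}}}

ι : ℕ → ℚ
ι zero    = 0ℚ
ι (suc n) = 1ℚ + ι n

ι-+ : ∀ a b → ι (a ℕ.+ b) ≡ ι a + ι b
ι-+ zero    b = sym (+-identityˡ (ι b))
ι-+ (suc a) b = trans (cong (λ z → 1ℚ + z) (ι-+ a b)) (sym (+-assoc 1ℚ (ι a) (ι b)))

ι-≥0 : ∀ a → 0ℚ ≤ ι a
ι-≥0 zero    = ≤-refl
ι-≥0 (suc a) = +-mono-≤ (≤ᵇ⇒≤ {0ℚ} {1ℚ} tt) (ι-≥0 a)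

ι-pos : ∀ a → 0ℚ < ι (suc a)
ι-pos a = +-mono-<-≤ (positive⁻¹ 1ℚ) (ι-≥0 a)

ι-mono : ∀ {a b} → a ℕ.≤ b → ι a ≤ ι b
ι-mono {b = b} z≤n = ι-≥0 b
ι-mono (s≤s a≤b)   = +-monoʳ-≤ 1ℚ (ι-mono a≤b)

-- ι reflects strict order; used to turn a rational coverage test into a bound
-- on natural-number weights.
ι-cancel-< : ∀ {a b} → ι a < ι b → a ℕ.< b
ι-cancel-< ιa<ιb = ℕₚ.≰⇒> λ b≤a → <-irrefl refl (<-≤-trans ιa<ιb (ι-mono b≤a))

recip : ℕ → ℚ
recip k = + 1 / suc k

recip-≥0 : ∀ k → 0ℚ ≤ recip k
recip-≥0 k = nonNegative⁻¹ (recip k) {{normalize-nonNeg 1 (suc k)}}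

-- ι (k+1) and 1/(k+1) are inverse; checked in the unnormalised rationals,
-- where ι n is n/1.
ι-inverse : ∀ k → ι (suc k) * recip k ≡ 1ℚ
ι-inverse k = toℚᵘ-injective (ℚᵘ.≃-trans (toℚᵘ-homo-* (ι (suc k)) (recip k))
  (ℚᵘ.≃-trans (ℚᵘ.*-cong (ι-as-fraction (suc k)) (toℚᵘ-fromℚᵘ (ℚᵘ.mkℚᵘ (+ 1) k)))
              (ℚᵘ.*≡* (solve 1 (λ n → (n :* con (+ 1)) :* con (+ 1) := con (+ 1) :* (con (+ 1) :* n)) refl (+ suc k)))))
  where
  open ℤ-Solver.+-*-Solver
  ι-as-fraction : ∀ n → toℚᵘ (ι n) ℚᵘ.≃ ℚᵘ.mkℚᵘ (+ n) 0
  ι-as-fraction zero    = ℚᵘ.≃-refl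
  ι-as-fraction (suc n) = ℚᵘ.≃-trans (toℚᵘ-homo-+ 1ℚ (ι n))
    (ℚᵘ.≃-trans (ℚᵘ.+-congʳ (toℚᵘ 1ℚ) (ι-as-fraction n))
      (ℚᵘ.*≡* (solve 1 (λ n → (con (+ 1) :* con (+ 1) :+ n :* con (+ 1)) :* con (+ 1)
                           := (con (+ 1) :+ n) :* (con (+ 1) :* con (+ 1))) refl (+ n))))

open +-*-Solver using (solve; _:+_; _:*_; _:=_; con)

H-≥0 : ∀ k → 0ℚ ≤ H k
H-≥0 zero    = ≤-refl
H-≥0 (suc k) = +-mono-≤ (H-≥0 k) (recip-≥0 k)

H-mono : ∀ {a b} → a ℕ.≤ b → H a ≤ H b
H-mono a≤b = mono′ (ℕₚ.≤⇒≤′ a≤b)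
  where
  H-step : ∀ k → H k ≤ H (suc k)
  H-step k = ≤-trans (≤-reflexive (sym (+-identityʳ (H k)))) (+-monoʳ-≤ (H k) (recip-≥0 k))
  mono′ : ∀ {a b} → a ≤′ b → H a ≤ H b
  mono′ ≤′-refl                  = ≤-refl
  mono′ (≤′-step {n = b} a≤′b) = ≤-trans (mono′ a≤′b) (H-step b)

-- H(j+n) − H(n) ≥ j/(j+n), each of the j new terms being at least 1/(j+n);
-- written multiplied out.
harmonic-tail : ∀ n j → ι (j ℕ.+ n) * H n + ι j ≤ ι (j ℕ.+ n) * H (j ℕ.+ n)
harmonic-tail n zero    = ≤-reflexive (+-identityʳ _)
harmonic-tail n (suc j) = begin
  (1ℚ + ι N) * H n + (1ℚ + ι j)
    ≡⟨ solve 3 (λ a b c → (con 1ℚ :+ a) :* b :+ (con 1ℚ :+ c) := (a :* b :+ c) :+ (b :+ con 1ℚ))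
             refl (ι N) (H n) (ι j) ⟩
  (ι N * H n + ι j) + (H n + 1ℚ)
    ≤⟨ +-mono-≤ (harmonic-tail n j) (+-monoˡ-≤ 1ℚ (H-mono (ℕₚ.m≤n+m n j))) ⟩
  ι N * H N + (H N + 1ℚ)
    ≡⟨ cong (λ z → ι N * H N + (H N + z)) (sym (ι-inverse N)) ⟩
  ι N * H N + (H N + (1ℚ + ι N) * recip N)
    ≡⟨ solve 3 (λ a b c → a :* b :+ (b :+ (con 1ℚ :+ a) :* c) := (con 1ℚ :+ a) :* (b :+ c))
             refl (ι N) (H N) (recip N) ⟩
  (1ℚ + ι N) * (H N + recip N) ∎
  where
  open ≤-Reasoning
  N = j ℕ.+ n

harmonic-double : ∀ a → ι 2 * H (suc a) + 1ℚ ≤ ι 2 * H (suc a ℕ.+ suc a)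
harmonic-double a = *-cancelˡ-≤-pos (ι A) {{positive (ι-pos a)}} (begin
  ι A * (ι 2 * H A + 1ℚ)
    ≡⟨ solve 2 (λ x h → x :* ((con 1ℚ :+ (con 1ℚ :+ con 0ℚ)) :* h :+ con 1ℚ) := (x :+ x) :* h :+ x)
             refl (ι A) (H A) ⟩
  (ι A + ι A) * H A + ι A
    ≡⟨ cong (λ z → z * H A + ι A) (sym (ι-+ A A)) ⟩
  ι (A ℕ.+ A) * H A + ι A
    ≤⟨ harmonic-tail A A ⟩
  ι (A ℕ.+ A) * H (A ℕ.+ A)
    ≡⟨ cong (_* H (A ℕ.+ A)) (ι-+ A A) ⟩
  (ι A + ι A) * H (A ℕ.+ A)
    ≡⟨ solve 2 (λ x h → (x :+ x) :* h := x :* ((con 1ℚ :+ (con 1ℚ :+ con 0ℚ)) :* h))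
             refl (ι A) (H (A ℕ.+ A)) ⟩
  ι A * (ι 2 * H (A ℕ.+ A)) ∎)
  where
  open ≤-Reasoning
  A = suc a

harmonic-log : ∀ k → ι (2 ℕ.+ k) ≤ ι 2 * H (2 ℕ.^ k)
harmonic-log zero    = ≤ᵇ⇒≤ tt
harmonic-log (suc k) with 2 ℕ.^ k | ℕₚ.m^n>0 2 k | harmonic-log k
... | suc p | _ | ih = begin
  1ℚ + ι (2 ℕ.+ k)              ≤⟨ +-monoʳ-≤ 1ℚ ih ⟩
  1ℚ + ι 2 * H (suc p)          ≡⟨ +-comm 1ℚ (ι 2 * H (suc p)) ⟩
  ι 2 * H (suc p) + 1ℚ          ≤⟨ harmonic-double p ⟩
  ι 2 * H (suc p ℕ.+ suc p)     ≡⟨ cong (λ z → ι 2 * H (suc p ℕ.+ z)) (sym (ℕₚ.+-identityʳ (suc p))) ⟩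
  ι 2 * H (suc p ℕ.+ (suc p ℕ.+ 0)) ∎
  where open ≤-Reasoning

val : ℕ → ℕ
val zero    = 0
val (suc l) = 2 ℕ.^ l

val-mono : ∀ {a b} → a ℕ.≤ b → val a ℕ.≤ val b
val-mono z≤n       = z≤n
val-mono (s≤s a≤b) = ℕₚ.^-monoʳ-≤ 2 a≤b

val-raise : ∀ l → val (suc l) ℕ.≤ val l ℕ.+ val l ℕ.+ 1
val-raise zero    = s≤s z≤n
val-raise (suc l) = ℕₚ.≤-trans (ℕₚ.≤-reflexive (cong (2 ℕ.^ l ℕ.+_) (ℕₚ.+-identityʳ (2 ℕ.^ l))))
                               (ℕₚ.m≤m+n _ 1)

val-large : ∀ n → n ℕ.≤ val (suc n)
val-large zero    = z≤n
val-large (suc n) = ℕₚ.≤-trans (ℕₚ.+-mono-≤ (ℕₚ.m^n>0 2 n) (val-large n))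
                               (ℕₚ.≤-reflexive (cong (2 ℕ.^ n ℕ.+_) (sym (ℕₚ.+-identityʳ (2 ℕ.^ n)))))

level-bound : ∀ {m} l → val l ℕ.< m ℕ.+ m → ι l ≤ ι 2 * H m
level-bound {m} zero _ = *-≥0 (ι-≥0 2) (H-≥0 m)
level-bound {suc k} (suc zero) _ = ≤-trans (≤ᵇ⇒≤ tt) (*-monoˡ-≤-≥0 (ι-≥0 2) (H-mono (s≤s (z≤n {k}))))
level-bound {m} (suc (suc k)) 2^k+2^k<m+m =
  ≤-trans (harmonic-log k) (*-monoˡ-≤-≥0 (ι-≥0 2) (H-mono (ℕₚ.<⇒≤ 2^k<m)))
  where
  2^k<m : 2 ℕ.^ k ℕ.< m
  2^k<m = ℕₚ.*-cancelˡ-< 2 (2 ℕ.^ k) m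
            (subst₂ ℕ._<_ refl (cong (m ℕ.+_) (sym (ℕₚ.+-identityʳ m))) 2^k+2^k<m+m)

sumFin-cong : ∀ m {f g : Fin m → ℚ} → (∀ j → f j ≡ g j) → sumFin m f ≡ sumFin m g
sumFin-cong zero    f≗g = refl
sumFin-cong (suc m) f≗g = cong₂ _+_ (f≗g zero) (sumFin-cong m (λ j → f≗g (suc j)))

sumFin-+ : ∀ m (f g : Fin m → ℚ) → sumFin m (λ j → f j + g j) ≡ sumFin m f + sumFin m g
sumFin-+ zero    f g = sym (+-identityˡ 0ℚ)
sumFin-+ (suc m) f g = trans (cong (λ z → f zero + g zero + z) (sumFin-+ m (λ j → f (suc j)) (λ j → g (suc j))))
  (solve 4 (λ a b c d → (a :+ b) :+ (c :+ d) := (a :+ c) :+ (b :+ d))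
     refl (f zero) (g zero) (sumFin m (λ j → f (suc j))) (sumFin m (λ j → g (suc j))))

sumFin-*ˡ : ∀ m c (f : Fin m → ℚ) → sumFin m (λ j → c * f j) ≡ c * sumFin m f
sumFin-*ˡ zero    c f = sym (*-zeroʳ c)
sumFin-*ˡ (suc m) c f = trans (cong (λ z → c * f zero + z) (sumFin-*ˡ m c (λ j → f (suc j))))
                              (sym (*-distribˡ-+ c (f zero) _))

sumFin-mono : ∀ m {f g : Fin m → ℚ} → (∀ j → f j ≤ g j) → sumFin m f ≤ sumFin m g
sumFin-mono zero    f≤g = ≤-refl
sumFin-mono (suc m) f≤g = +-mono-≤ (f≤g zero) (sumFin-mono m (λ j → f≤g (suc j)))

sumFin-≥0 : ∀ m {f : Fin m → ℚ} → (∀ j → 0ℚ ≤ f j) → 0ℚ ≤ sumFin m f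
sumFin-≥0 zero    f≥0 = ≤-refl
sumFin-≥0 (suc m) f≥0 = +-mono-≤ (f≥0 zero) (sumFin-≥0 m (λ j → f≥0 (suc j)))

sumFin-term : ∀ m {f : Fin m → ℚ} → (∀ j → 0ℚ ≤ f j) → ∀ j → f j ≤ sumFin m f
sumFin-term (suc m) {f} f≥0 zero    =
  ≤-trans (≤-reflexive (sym (+-identityʳ (f zero)))) (+-monoʳ-≤ (f zero) (sumFin-≥0 m (λ j → f≥0 (suc j))))
sumFin-term (suc m) {f} f≥0 (suc j) =
  ≤-trans (sumFin-term m (λ j → f≥0 (suc j)) j) (≤-trans (≤-reflexive (sym (+-identityˡ _))) (+-monoˡ-≤ _ (f≥0 zero)))

sumFin-ones : ∀ m → sumFin m (λ _ → 1ℚ) ≡ ι m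
sumFin-ones zero    = refl
sumFin-ones (suc m) = cong (λ z → 1ℚ + z) (sumFin-ones m)

scale : ∀ {m} → ℚ → Assign m → Assign m
scale c x j = c * x j

coverage-scale : ∀ {n m} (S : SetSystem n m) c x σ → coverage S (scale c x) σ ≡ c * coverage S x σ
coverage-scale {m = m} S c x σ =
  trans (sumFin-cong m (λ j → pull (S j σ) (x j))) (sumFin-*ˡ m c _)
  where
  pull : ∀ b v → (if b then c * v else 0ℚ) ≡ c * (if b then v else 0ℚ)
  pull true  v = refl
  pull false v = sym (*-zeroʳ c)

coverage-mono : ∀ {n m} (S : SetSystem n m) {x x′} σ → x ≤ᵥ x′ → coverage S x σ ≤ coverage S x′ σ
coverage-mono {m = m} S σ x≤x′ = sumFin-mono m λ j → select (S j σ) (x≤x′ j)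
  where
  select : ∀ b {v w} → v ≤ w → (if b then v else 0ℚ) ≤ (if b then w else 0ℚ)
  select true  v≤w = v≤w
  select false _   = ≤-refl

coverage-member : ∀ {n m} (S : SetSystem n m) {x} σ → Nonneg x → ∀ j → S j σ ≡ true → x j ≤ coverage S x σ
coverage-member {m = m} S {x} σ x≥0 j j∋σ =
  subst (λ b → (if b then x j else 0ℚ) ≤ coverage S x σ) j∋σ
        (sumFin-term m (λ i → select≥0 (S i σ) (x≥0 i)) j)
  where
  select≥0 : ∀ b {v} → 0ℚ ≤ v → 0ℚ ≤ (if b then v else 0ℚ)
  select≥0 true  v≥0 = v≥0
  select≥0 false _   = ≤-refl

coverage-≤-cost : ∀ {n m} (S : SetSystem n m) {x} σ → Nonneg x → coverage S x σ ≤ cost x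
coverage-≤-cost {m = m} S σ x≥0 = sumFin-mono m λ j → select≤ (S j σ) (x≥0 j)
  where
  select≤ : ∀ b {v} → 0ℚ ≤ v → (if b then v else 0ℚ) ≤ v
  select≤ true  _   = ≤-refl
  select≤ false v≥0 = v≥0

Levels : ℕ → Set
Levels m = Fin m → ℕ

_≤ₗ_ : ∀ {m} → Levels m → Levels m → Set
ℓ ≤ₗ ℓ′ = ∀ j → ℓ j ℕ.≤ ℓ′ j

≤ₗ-refl : ∀ {m} {ℓ : Levels m} → ℓ ≤ₗ ℓ
≤ₗ-refl j = ℕₚ.≤-refl

≤ₗ-trans : ∀ {m} {ℓ ℓ′ ℓ″ : Levels m} → ℓ ≤ₗ ℓ′ → ℓ′ ≤ₗ ℓ″ → ℓ ≤ₗ ℓ″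
≤ₗ-trans p q j = ℕₚ.≤-trans (p j) (q j)

weights : ∀ {m} → Levels m → Assign m
weights ℓ j = ι (val (ℓ j))

weights-≥0 : ∀ {m} (ℓ : Levels m) → Nonneg (weights ℓ)
weights-≥0 ℓ j = ι-≥0 (val (ℓ j))

weights-mono : ∀ {m} {ℓ ℓ′ : Levels m} → ℓ ≤ₗ ℓ′ → weights ℓ ≤ᵥ weights ℓ′
weights-mono ℓ≤ℓ′ j = ι-mono (val-mono (ℓ≤ℓ′ j))

bump : ∀ {n m} → SetSystem n m → Fin n → Levels m → Levels m
bump S σ ℓ j = if S j σ then suc (ℓ j) else ℓ j

bump-≥ : ∀ {n m} (S : SetSystem n m) σ ℓ → ℓ ≤ₗ bump S σ ℓ
bump-≥ S σ ℓ j with S j σ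
... | true  = ℕₚ.n≤1+n (ℓ j)
... | false = ℕₚ.≤-refl

raise : ∀ {n m} → ℕ → SetSystem n m → Fin n → (fuel : ℕ) → Levels m → Levels m
raise d S σ zero       ℓ = ℓ
raise d S σ (suc fuel) ℓ with ι d ≤? coverage S (weights ℓ) σ
... | yes _ = ℓ
... | no  _ = raise d S σ fuel (bump S σ ℓ)

raiseBatch : ∀ {n m} → ℕ → SetSystem n m → Batch n → Levels m → Levels m
raiseBatch d S []      ℓ = ℓ
raiseBatch d S (σ ∷ b) ℓ = raiseBatch d S b (raise d S σ (suc d) ℓ)

levels : ∀ {n m} → SetSystem n m → List (Batch n) → Levels m
levels {m = m} S bs = foldl (λ ℓ b → raiseBatch m S b ℓ) (λ _ → 0) bs

Alg : Algorithm
Alg n zero    S bs ()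
Alg n (suc k) S bs = scale (recip k) (weights (levels S bs))

raise-≥ : ∀ {n m} d (S : SetSystem n m) σ fuel ℓ → ℓ ≤ₗ raise d S σ fuel ℓ
raise-≥ d S σ zero       ℓ = ≤ₗ-refl
raise-≥ d S σ (suc fuel) ℓ with ι d ≤? coverage S (weights ℓ) σ
... | yes _ = ≤ₗ-refl
... | no  _ = ≤ₗ-trans (bump-≥ S σ ℓ) (raise-≥ d S σ fuel (bump S σ ℓ))

raiseBatch-≥ : ∀ {n m} d (S : SetSystem n m) b ℓ → ℓ ≤ₗ raiseBatch d S b ℓ
raiseBatch-≥ d S []      ℓ = ≤ₗ-refl
raiseBatch-≥ d S (σ ∷ b) ℓ = ≤ₗ-trans (raise-≥ d S σ (suc d) ℓ) (raiseBatch-≥ d S b _)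

-- Raising succeeds once a set j ∋ σ would reach weight d within the fuel,
-- since every bump raises j.
raise-covers : ∀ {n m} d (S : SetSystem n m) σ j → S j σ ≡ true → ∀ fuel ℓ →
               d ℕ.≤ val (ℓ j ℕ.+ fuel) → ι d ≤ coverage S (weights (raise d S σ fuel ℓ)) σ
raise-covers d S σ j j∋σ zero ℓ d≤val =
  ≤-trans (ι-mono (subst (λ l → d ℕ.≤ val l) (ℕₚ.+-identityʳ (ℓ j)) d≤val))
          (coverage-member S σ (weights-≥0 ℓ) j j∋σ)
raise-covers d S σ j j∋σ (suc fuel) ℓ d≤val with ι d ≤? coverage S (weights ℓ) σ
... | yes covered = covered
... | no  _       = raise-covers d S σ j j∋σ fuel (bump S σ ℓ)
                      (subst (λ l → d ℕ.≤ val (l ℕ.+ fuel)) bumped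
                             (subst (λ l → d ℕ.≤ val l) (ℕₚ.+-suc (ℓ j) fuel) d≤val))
  where
  bumped : suc (ℓ j) ≡ bump S σ ℓ j
  bumped = sym (cong (λ b → if b then suc (ℓ j) else ℓ j) j∋σ)

raiseBatch-covers : ∀ {n m} d (S : SetSystem n m) b ℓ → ValidBatch S b →
                    All (λ σ → ι d ≤ coverage S (weights (raiseBatch d S b ℓ)) σ) b
raiseBatch-covers d S []      ℓ []                  = []
raiseBatch-covers d S (σ ∷ b) ℓ ((j , j∋σ) ∷ valid) =
  ≤-trans (raise-covers d S σ j j∋σ (suc d) ℓ
             (ℕₚ.≤-trans (val-large d) (val-mono (ℕₚ.m≤n+m (suc d) (ℓ j)))))
          (coverage-mono S σ (weights-mono (raiseBatch-≥ d S b _)))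
  ∷ raiseBatch-covers d S b _ valid

-- Correctness: x starts at 0, only grows, and every revealed element is
-- covered, because weighted coverage m means fractional coverage 1.
alg-correct : Correct Alg
alg-correct n zero    S = (λ ()) , λ hist b _ valid → (λ ()) , All.map (λ { (() , _) }) valid
alg-correct n (suc k) S = (λ j → *-≥0 (recip-≥0 k) (ι-≥0 0)) , λ hist b _ valid →
  subst (Step (levels S hist) b) (sym (after hist b))
        (grows (levels S hist) b , covers (levels S hist) b valid)
  where
  x : Levels (suc k) → Assign (suc k)
  x ℓ = scale (recip k) (weights ℓ)
  Step : Levels (suc k) → Batch n → Levels (suc k) → Set
  Step ℓ b ℓ′ = (x ℓ ≤ᵥ x ℓ′) × All (λ σ → 1ℚ ≤ coverage S (x ℓ′) σ) b
  after : ∀ hist b → levels S (hist ++ (b ∷ [])) ≡ raiseBatch (suc k) S b (levels S hist)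
  after hist b = foldl-++ (λ ℓ b → raiseBatch (suc k) S b ℓ) (λ _ → 0) hist (b ∷ [])
  grows : ∀ ℓ b → x ℓ ≤ᵥ x (raiseBatch (suc k) S b ℓ)
  grows ℓ b j = *-monoˡ-≤-≥0 (recip-≥0 k) (weights-mono (raiseBatch-≥ (suc k) S b ℓ) j)
  normalised : ∀ ℓ {σ} → ι (suc k) ≤ coverage S (weights ℓ) σ → 1ℚ ≤ coverage S (x ℓ) σ
  normalised ℓ {σ} m≤cov = begin
    1ℚ                                    ≡⟨ sym (trans (*-comm (recip k) (ι (suc k))) (ι-inverse k)) ⟩
    recip k * ι (suc k)                   ≤⟨ *-monoˡ-≤-≥0 (recip-≥0 k) m≤cov ⟩
    recip k * coverage S (weights ℓ) σ    ≡⟨ sym (coverage-scale S (recip k) (weights ℓ) σ) ⟩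
    coverage S (x ℓ) σ                    ∎
    where open ≤-Reasoning
  covers : ∀ ℓ b → ValidBatch S b → All (λ σ → 1ℚ ≤ coverage S (x (raiseBatch (suc k) S b ℓ)) σ) b
  covers ℓ b valid = All.map (normalised (raiseBatch (suc k) S b ℓ)) (raiseBatch-covers (suc k) S b ℓ valid)

potential : ∀ {m} → Assign m → Levels m → ℚ
potential {m} y ℓ = sumFin m (λ j → ι (ℓ j) * y j)

bump-potential : ∀ {n m} (S : SetSystem n m) σ y ℓ →
                 potential y (bump S σ ℓ) ≡ potential y ℓ + coverage S y σ
bump-potential {m = m} S σ y ℓ =
  trans (sumFin-cong m (λ j → raised (S j σ) (ℓ j) (y j))) (sumFin-+ m _ _)
  where
  raised : ∀ b l v → ι (if b then suc l else l) * v ≡ ι l * v + (if b then v else 0ℚ)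
  raised true  l v = solve 2 (λ a v → (con 1ℚ :+ a) :* v := a :* v :+ v) refl (ι l) v
  raised false l v = sym (+-identityʳ (ι l * v))

-- A bump for σ adds at most (weighted coverage of σ) + m to the total weight,
-- since each raised set at most doubles its weight plus one.
bump-weight : ∀ {n m} (S : SetSystem n m) σ ℓ →
              cost (weights (bump S σ ℓ)) ≤ (cost (weights ℓ) + coverage S (weights ℓ) σ) + ι m
bump-weight {m = m} S σ ℓ = begin
  cost (weights (bump S σ ℓ))
    ≤⟨ sumFin-mono m (λ j → raised (S j σ) (ℓ j)) ⟩
  sumFin m (λ j → (weights ℓ j + select j (weights ℓ j)) + select j 1ℚ)
    ≡⟨ trans (sumFin-+ m _ _) (cong (_+ coverage S (λ _ → 1ℚ) σ) (sumFin-+ m _ _)) ⟩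
  (cost (weights ℓ) + coverage S (weights ℓ) σ) + coverage S (λ _ → 1ℚ) σ
    ≤⟨ +-monoʳ-≤ (cost (weights ℓ) + coverage S (weights ℓ) σ) (≤-trans (coverage-≤-cost S σ (λ _ → ≤ᵇ⇒≤ tt)) (≤-reflexive (sumFin-ones m))) ⟩
  (cost (weights ℓ) + coverage S (weights ℓ) σ) + ι m ∎
  where
  open ≤-Reasoning
  select : Fin m → ℚ → ℚ
  select j v = if S j σ then v else 0ℚ
  raised : ∀ b l → ι (val (if b then suc l else l))
                   ≤ (ι (val l) + (if b then ι (val l) else 0ℚ)) + (if b then 1ℚ else 0ℚ)
  raised true  l = ≤-trans (ι-mono (val-raise l)) (≤-reflexive (trans (ι-+ (val l ℕ.+ val l) 1)
                                                                        (cong (_+ 1ℚ) (ι-+ (val l) (val l)))))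
  raised false l = ≤-reflexive (sym (trans (+-identityʳ _) (+-identityʳ _)))

Charged : ∀ {m} → Assign m → Levels m → Set
Charged {m} y ℓ = (∀ j → val (ℓ j) ℕ.< m ℕ.+ m) × cost (weights ℓ) ≤ ι (m ℕ.+ m) * potential y ℓ

bump-charged : ∀ {n m} (S : SetSystem n m) σ y ℓ →
               coverage S (weights ℓ) σ < ι m → 1ℚ ≤ coverage S y σ →
               Charged y ℓ → Charged y (bump S σ ℓ)
bump-charged {m = m} S σ y ℓ uncovered y-covers (small , charged) = small′ , (begin
  cost (weights (bump S σ ℓ))
    ≤⟨ bump-weight S σ ℓ ⟩
  (cost (weights ℓ) + coverage S (weights ℓ) σ) + ι m
    ≤⟨ +-monoˡ-≤ (ι m) (+-mono-≤ charged (<⇒≤ uncovered)) ⟩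
  (ι (m ℕ.+ m) * potential y ℓ + ι m) + ι m
    ≡⟨ cong (λ z → (z * potential y ℓ + ι m) + ι m) (ι-+ m m) ⟩
  ((ι m + ι m) * potential y ℓ + ι m) + ι m
    ≡⟨ solve 2 (λ a p → (((a :+ a) :* p) :+ a) :+ a := (a :+ a) :* p :+ (a :+ a) :* con 1ℚ) refl (ι m) (potential y ℓ) ⟩
  (ι m + ι m) * potential y ℓ + (ι m + ι m) * 1ℚ
    ≡⟨ cong (λ z → z * potential y ℓ + z * 1ℚ) (sym (ι-+ m m)) ⟩
  ι (m ℕ.+ m) * potential y ℓ + ι (m ℕ.+ m) * 1ℚ
    ≤⟨ +-monoʳ-≤ (ι (m ℕ.+ m) * potential y ℓ) (*-monoˡ-≤-≥0 (ι-≥0 (m ℕ.+ m)) y-covers) ⟩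
  ι (m ℕ.+ m) * potential y ℓ + ι (m ℕ.+ m) * coverage S y σ
    ≡⟨ sym (*-distribˡ-+ (ι (m ℕ.+ m)) _ _) ⟩
  ι (m ℕ.+ m) * (potential y ℓ + coverage S y σ)
    ≡⟨ cong (ι (m ℕ.+ m) *_) (sym (bump-potential S σ y ℓ)) ⟩
  ι (m ℕ.+ m) * potential y (bump S σ ℓ) ∎)
  where
  open ≤-Reasoning
  -- A raised set had weight below m, so its new weight is below 2m.
  small′ : ∀ j → val (bump S σ ℓ j) ℕ.< m ℕ.+ m
  small′ j with S j σ in j∋σ
  ... | false = small j
  ... | true  = ℕₚ.≤-<-trans (val-raise (ℓ j)) (doubled below-m)
    where
    below-m : val (ℓ j) ℕ.< m
    below-m = ι-cancel-< (≤-<-trans (coverage-member S σ (weights-≥0 ℓ) j j∋σ) uncovered)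
    doubled : ∀ {v} → v ℕ.< m → v ℕ.+ v ℕ.+ 1 ℕ.< m ℕ.+ m
    doubled {v} v<m = subst (ℕ._≤ m ℕ.+ m) (cong suc (trans (ℕₚ.+-suc v v) (ℕₚ.+-comm 1 (v ℕ.+ v))))
                            (ℕₚ.+-mono-≤ v<m v<m)

raise-charged : ∀ {n m} (S : SetSystem n m) σ y → 1ℚ ≤ coverage S y σ →
                ∀ fuel ℓ → Charged y ℓ → Charged y (raise m S σ fuel ℓ)
raise-charged S σ y y-covers zero       ℓ inv = inv
raise-charged {m = m} S σ y y-covers (suc fuel) ℓ inv with ι m ≤? coverage S (weights ℓ) σ
... | yes _       = inv
... | no  m≰cover = raise-charged S σ y y-covers fuel (bump S σ ℓ)
                      (bump-charged S σ y ℓ (≰⇒> m≰cover) y-covers inv)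

raiseBatch-charged : ∀ {n m} (S : SetSystem n m) y b → All (λ σ → 1ℚ ≤ coverage S y σ) b →
                     ∀ ℓ → Charged y ℓ → Charged y (raiseBatch m S b ℓ)
raiseBatch-charged S y []      []                  ℓ inv = inv
raiseBatch-charged {m = m} S y (σ ∷ b) (y-covers ∷ covers) ℓ inv =
  raiseBatch-charged S y b covers _ (raise-charged S σ y y-covers (suc m) ℓ inv)

index⇒pos : ∀ {m} → Fin m → 0 ℕ.< m ℕ.+ m
index⇒pos {suc m} _ = s≤s z≤n

levels-charged : ∀ {n m} (S : SetSystem n m) bs y → FeasibleFor S bs y → Charged y (levels S bs)
levels-charged {m = m} S bs y (y≥0 , feasible) = go bs feasible (λ _ → 0) initial
  where
  initial : Charged y (λ _ → 0)
  initial = (λ j → index⇒pos j) , (begin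
    sumFin m (λ _ → 0ℚ)          ≡⟨ trans (sumFin-*ˡ m 0ℚ (λ _ → 0ℚ)) (*-zeroˡ (sumFin m (λ _ → 0ℚ))) ⟩
    0ℚ                           ≤⟨ *-≥0 (ι-≥0 (m ℕ.+ m)) (sumFin-≥0 m (λ j → *-≥0 (≤-refl) (y≥0 j))) ⟩
    ι (m ℕ.+ m) * potential y (λ _ → 0) ∎)
    where
    open ≤-Reasoning
  go : ∀ bs → All (λ b → All (λ σ → 1ℚ ≤ coverage S y σ) b) bs →
       ∀ ℓ → Charged y ℓ → Charged y (foldl (λ ℓ b → raiseBatch m S b ℓ) ℓ bs)
  go []       []                ℓ inv = inv
  go (b ∷ bs) (covers ∷ feasible) ℓ inv = go bs feasible (raiseBatch m S b ℓ) (raiseBatch-charged S y b covers ℓ inv)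

-- With all weights below 2m, every level is at most 2·H_m, so the potential
-- is at most 2·H_m · cost y.
potential-bound : ∀ {m} (y : Assign m) ℓ → Nonneg y → (∀ j → val (ℓ j) ℕ.< m ℕ.+ m) →
                  potential y ℓ ≤ (ι 2 * H m) * cost y
potential-bound {m} y ℓ y≥0 small =
  ≤-trans (sumFin-mono m (λ j → *-monoʳ-≤-≥0 (y≥0 j) (level-bound {m} (ℓ j) (small j))))
          (≤-reflexive (sumFin-*ˡ m (ι 2 * H m) y))

alg-competitive : ∀ {n} k (S : SetSystem n (suc k)) bs (y : Assign (suc k)) → FeasibleFor S bs y →
                  cost (Alg n (suc k) S bs) ≤ (ι 4 * H (suc k)) * cost y
alg-competitive {n} k S bs y feasible@(y≥0 , _) = begin
  cost (Alg n M S bs)                         ≡⟨ sumFin-*ˡ M (recip k) (weights ℓ) ⟩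
  recip k * cost (weights ℓ)                  ≤⟨ *-monoˡ-≤-≥0 (recip-≥0 k) charged ⟩
  recip k * (ι (M ℕ.+ M) * potential y ℓ)     ≤⟨ *-monoˡ-≤-≥0 (recip-≥0 k) (*-monoˡ-≤-≥0 (ι-≥0 (M ℕ.+ M))
                                                   (potential-bound y ℓ y≥0 small)) ⟩
  recip k * (ι (M ℕ.+ M) * ((ι 2 * H M) * cost y))
    ≡⟨ cong (λ z → recip k * (z * ((ι 2 * H M) * cost y))) (ι-+ M M) ⟩
  recip k * ((ι M + ι M) * ((ι 2 * H M) * cost y))
    ≡⟨ solve 4 (λ r a h c → r :* ((a :+ a) :* ((con (ι 2) :* h) :* c)) := (a :* r) :* ((con (ι 4) :* h) :* c))
             refl (recip k) (ι M) (H M) (cost y) ⟩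
  (ι M * recip k) * ((ι 4 * H M) * cost y)    ≡⟨ cong (_* ((ι 4 * H M) * cost y)) (ι-inverse k) ⟩
  1ℚ * ((ι 4 * H M) * cost y)                 ≡⟨ *-identityˡ _ ⟩
  (ι 4 * H M) * cost y                        ∎
  where
  open ≤-Reasoning
  M = suc k
  ℓ = levels S bs
  small : ∀ j → val (ℓ j) ℕ.< M ℕ.+ M
  small = proj₁ (levels-charged S bs y feasible)
  charged : cost (weights ℓ) ≤ ι (M ℕ.+ M) * potential y ℓ
  charged = proj₂ (levels-charged S bs y feasible)

lemma5 : Σ Algorithm λ A → Σ ℚ λ C →
           Correct A × (0ℚ < C) ×
           (∀ (n m : ℕ) → m ≥ 1 → (S : SetSystem n m) (bs : List (Batch n)) →
              ValidSeq S bs →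
              ∀ (y : Assign m) → FeasibleFor S bs y →
              cost (A n m S bs) ≤ (C * H m) * cost y)
lemma5 = Alg , ι 4 , alg-correct , ι-pos 3 , competitive
  where
  competitive : ∀ (n m : ℕ) → m ≥ 1 → (S : SetSystem n m) (bs : List (Batch n)) →
                ValidSeq S bs → ∀ (y : Assign m) → FeasibleFor S bs y →
                cost (Alg n m S bs) ≤ (ι 4 * H m) * cost y
  competitive n (suc k) _ S bs _ y feasible = alg-competitive k S bs y feasible
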